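{- Let $k\geq 3$ and let $T$ be a full $k$-ary tree of height $h$, and let $t = (h-1) \bmod 2$. Then $\mathrm{cdn}(T) = \dfrac{k^{h+1}-k^t}{k^2-1}$.
   Context: A claw is $K_{1,3}$. $\mathrm{cdn}(G)$ is the minimum number of vertices whose deletion from $G$ leaves a graph with no induced $K_{1,3}$. A full $k$-ary tree is a rooted tree in which every node has either zero or exactly $k$ children and all leaves have the same depth; its height is the depth of its leaves (the depth of a vertex being its distance to the root). -}

module Defs where

open import Data.Nat using (ℕ; zero; suc; _+_; _*_; _≤_)
open import Data.Fin using (Fin; toℕ)
open import Data.Fin.Subset using (Subset; _∈_; _∉_; ∣_∣)
open import Data.Product using (Σ; ∃; _×_)
open import Relation.Binary.PropositionalEquality using (_≡_; _≢_)
open import Relation.Nullary using (¬_)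
open import Data.Sum using (_⊎_)

record Graph : Set₁ where
  field
    n     : ℕ
    Adj   : Fin n → Fin n → Set
    sym   : ∀ {u v} → Adj u v → Adj v u
    irref : ∀ {u} → ¬ Adj u u
open Graph public

InducedClawAvoiding : (G : Graph) → Subset (n G) → Set
InducedClawAvoiding G S =
  Σ (Fin (n G)) λ a → Σ (Fin (n G)) λ b → Σ (Fin (n G)) λ c → Σ (Fin (n G)) λ d →
    (a ∉ S) × (b ∉ S) × (c ∉ S) × (d ∉ S) ×
    (b ≢ c) × (b ≢ d) × (c ≢ d) ×
    Adj G a b × Adj G a c × Adj G a d ×
    ¬ Adj G b c × ¬ Adj G b d × ¬ Adj G c d

ClawFreeAfterDeleting : (G : Graph) → Subset (n G) → Set
ClawFreeAfterDeleting G S = ¬ InducedClawAvoiding G S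

IsCdn : Graph → ℕ → Set
IsCdn G m =
  (Σ (Subset (n G)) λ S → ClawFreeAfterDeleting G S × ∣ S ∣ ≡ m) ×
  (∀ (S : Subset (n G)) → ClawFreeAfterDeleting G S → m ≤ ∣ S ∣)

treeSize : ℕ → ℕ → ℕ
treeSize k zero    = 1
treeSize k (suc h) = 1 + k * treeSize k h

-- Heap numbering: root is 0, the children of vertex i are k*i+1, ..., k*i+k.
-- Child relation: j is a child of i.
ChildOf : (k : ℕ) {N : ℕ} → Fin N → Fin N → Set
ChildOf k j i = Σ (Fin k) λ c → toℕ j ≡ k * toℕ i + suc (toℕ c)

TreeAdj : (k h : ℕ) → Fin (treeSize k h) → Fin (treeSize k h) → Set
TreeAdj k h u v = ChildOf k v u ⊎ ChildOf k u v

private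
  open import Data.Nat.Properties using (m≤n*m; m≤m+n; +-suc; <-irrefl; ≤-trans)
  open import Relation.Binary.PropositionalEquality using (subst) renaming (sym to ≡sym)
  open import Data.Product using (_,_)
  open import Data.Sum using (inj₁; inj₂)
  import Data.Nat as N

  child-irref : (k : ℕ) {N : ℕ} {i : Fin N} → ¬ ChildOf k i i
  child-irref (suc k) {i = i} (c , eq) =
    <-irrefl refl′ (subst (λ x → toℕ i N.< x) (≡sym eq) lt)
    where
      open import Relation.Binary.PropositionalEquality using () renaming (refl to refl′)
      lt : toℕ i N.< suc k * toℕ i + suc (toℕ c)
      lt = subst (toℕ i N.<_) (≡sym (+-suc (suc k * toℕ i) (toℕ c)))
             (N.s≤s (≤-trans (m≤n*m (toℕ i) (suc k)) (m≤m+n _ _)))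

fullTree : (k h : ℕ) → Graph
fullTree k h = record
  { n     = treeSize k h
  ; Adj   = TreeAdj k h
  ; sym   = λ { (inj₁ p) → inj₂ p ; (inj₂ p) → inj₁ p }
  ; irref = λ { (inj₁ p) → child-irref k p ; (inj₂ p) → child-irref k p }
  }

-- Deleting the vertices at depths h − 1, h − 3, … leaves an edgeless graph, and there are
-- k^(h−1) + k^(h−3) + ⋯ of them. Conversely, as k ≥ 3, every internal vertex together with
-- three of its children is an induced claw, so a claw-free deletion set meets the closed star
-- of every internal vertex; the stars centred at depths h − 1, h − 3, … are pairwise disjoint,
-- which gives the matching lower bound. Summing the geometric series gives the closed form.
module Submission where

open import Defs hiding (sym)
open import Data.Nat using (ℕ; zero; suc; _+_; _*_; _∸_; _^_; _≤_; _<_; _%_; z≤n; s≤s; s≤s⁻¹; _<?_; NonZero)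
open import Data.Nat.Properties
open import Algebra.Properties.CommutativeSemigroup +-commutativeSemigroup using () renaming (interchange to +-interchange)
open import Data.Bool using (Bool; true; false; if_then_else_)
open import Data.Fin using (Fin; toℕ; fromℕ<) renaming (zero to fzero; suc to fsuc)
open import Data.Fin.Properties using (toℕ<n; toℕ-fromℕ<; toℕ-injective)
open import Data.Fin.Subset using (Subset; _∈_; ∣_∣)
open import Data.Fin.Subset.Properties using (_∈?_)
open import Data.Vec using ([]; _∷_; tabulate; here; there)
open import Data.Product using (Σ; _×_; _,_)
open import Data.Sum using (_⊎_; inj₁; inj₂; [_,_]; swap) renaming (map to ⊎-map)
open import Data.Empty using (⊥-elim)
open import Function using (_∘_)
open import Relation.Nullary using (¬_; yes; no; does)
open import Relation.Nullary.Decidable using (dec-true; dec-false)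
open import Relation.Binary.PropositionalEquality hiding ([_])

module _ (G : Graph) (S : Subset (n G)) where

  edgeCover⇒clawFree : (∀ {u v} → Adj G u v → u ∈ S ⊎ v ∈ S) → ClawFreeAfterDeleting G S
  edgeCover⇒clawFree cover (_ , _ , _ , _ , a∉S , b∉S , _ , _ , _ , _ , _ , ab , _) =
    [ a∉S , b∉S ] (cover ab)

  clawFree⇒clawMeets : ClawFreeAfterDeleting G S → ∀ {a b c d} →
    b ≢ c → b ≢ d → c ≢ d → Adj G a b → Adj G a c → Adj G a d →
    ¬ Adj G b c → ¬ Adj G b d → ¬ Adj G c d →
    a ∈ S ⊎ b ∈ S ⊎ c ∈ S ⊎ d ∈ S
  clawFree⇒clawMeets clawFree {a} {b} {c} {d} b≢c b≢d c≢d ab ac ad ¬bc ¬bd ¬cd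
    with a ∈? S | b ∈? S | c ∈? S | d ∈? S
  ... | yes a∈S | _       | _       | _       = inj₁ a∈S
  ... | no _    | yes b∈S | _       | _       = inj₂ (inj₁ b∈S)
  ... | no _    | no _    | yes c∈S | _       = inj₂ (inj₂ (inj₁ c∈S))
  ... | no _    | no _    | no _    | yes d∈S = inj₂ (inj₂ (inj₂ d∈S))
  ... | no a∉S  | no b∉S  | no c∉S  | no d∉S  = ⊥-elim (clawFree
    (a , b , c , d , a∉S , b∉S , c∉S , d∉S , b≢c , b≢d , c≢d , ab , ac , ad , ¬bc , ¬bd , ¬cd))

AllIn : ℕ → ℕ → (ℕ → Set) → Set
AllIn a n P = ∀ v → a ≤ v → v < a + n → P v

module _ {P : ℕ → Set} {a n : ℕ} where

  AllIn-head : AllIn a (suc n) P → P a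
  AllIn-head all = all a ≤-refl (m<m+n a (s≤s z≤n))

  AllIn-tail : AllIn a (suc n) P → AllIn (suc a) n P
  AllIn-tail all v a<v v< = all v (<⇒≤ a<v) (subst (v <_) (sym (+-suc a n)) v<)

  AllIn-shrink : ∀ {n′} → n ≤ n′ → AllIn a n′ P → AllIn a n P
  AllIn-shrink n≤n′ all v a≤v v< = all v a≤v (<-≤-trans v< (+-monoʳ-≤ a n≤n′))

boolToℕ : Bool → ℕ
boolToℕ true  = 1
boolToℕ false = 0

count : (ℕ → Bool) → ℕ → ℕ → ℕ
count f a zero    = 0
count f a (suc n) = boolToℕ (f a) + count f (suc a) n

module _ (f : ℕ → Bool) where

  count-+ : ∀ a m n → count f a (m + n) ≡ count f a m + count f (a + m) n
  count-+ a zero    n = cong (λ b → count f b n) (sym (+-identityʳ a))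
  count-+ a (suc m) n = begin
    boolToℕ (f a) + count f (suc a) (m + n)
      ≡⟨ cong (boolToℕ (f a) +_) (count-+ (suc a) m n) ⟩
    boolToℕ (f a) + (count f (suc a) m + count f (suc (a + m)) n)
      ≡⟨ sym (+-assoc (boolToℕ (f a)) _ _) ⟩
    count f a (suc m) + count f (suc (a + m)) n
      ≡⟨ cong (λ b → count f a (suc m) + count f b n) (sym (+-suc a m)) ⟩
    count f a (suc m) + count f (a + suc m) n ∎
    where open ≡-Reasoning

  count-suc : ∀ a n → count f (suc a) n ≡ count (f ∘ suc) a n
  count-suc a zero    = refl
  count-suc a (suc n) = cong (boolToℕ (f (suc a)) +_) (count-suc (suc a) n)

  count-allTrue : ∀ a n → AllIn a n (λ v → f v ≡ true) → count f a n ≡ n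
  count-allTrue a zero    _   = refl
  count-allTrue a (suc n) all rewrite AllIn-head all =
    cong suc (count-allTrue (suc a) n (AllIn-tail all))

  count-allFalse : ∀ a n → AllIn a n (λ v → f v ≡ false) → count f a n ≡ 0
  count-allFalse a zero    _   = refl
  count-allFalse a (suc n) all rewrite AllIn-head all =
    count-allFalse (suc a) n (AllIn-tail all)

  count-pos : ∀ a {n i} → i < n → f (a + i) ≡ true → 1 ≤ count f a n
  count-pos a {suc n} {zero}  _          fa rewrite +-identityʳ a | fa = s≤s z≤n
  count-pos a {suc n} {suc i} (s≤s i<n) fai =
    ≤-trans (count-pos (suc a) i<n (trans (cong f (sym (+-suc a i))) fai))
            (m≤n+m _ (boolToℕ (f a)))

count-cong : ∀ f g a n → AllIn a n (λ v → f v ≡ g v) → count f a n ≡ count g a n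
count-cong f g a zero    _   = refl
count-cong f g a (suc n) all =
  cong₂ _+_ (cong boolToℕ (AllIn-head all)) (count-cong f g (suc a) n (AllIn-tail all))

indicator : ∀ {N} → Subset N → ℕ → Bool
indicator []      _       = false
indicator (b ∷ S) zero    = b
indicator (b ∷ S) (suc i) = indicator S i

∈⇒indicator : ∀ {N} {S : Subset N} {x : Fin N} → x ∈ S → indicator S (toℕ x) ≡ true
∈⇒indicator here      = refl
∈⇒indicator (there p) = ∈⇒indicator p

indicator⇒∈ : ∀ {N} (S : Subset N) (x : Fin N) → indicator S (toℕ x) ≡ true → x ∈ S
indicator⇒∈ (true ∷ S) fzero    _ = here
indicator⇒∈ (b ∷ S)    (fsuc x) p = there (indicator⇒∈ S x p)

∣∣≡count-indicator : ∀ {N} (S : Subset N) → ∣ S ∣ ≡ count (indicator S) 0 N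
∣∣≡count-indicator []              = refl
∣∣≡count-indicator {suc N} (b ∷ S) =
  trans (∣b∷S∣ b) (cong (boolToℕ b +_) (sym (count-suc (indicator (b ∷ S)) 0 N)))
  where
    ∣b∷S∣ : ∀ b → ∣ b ∷ S ∣ ≡ boolToℕ b + count (indicator S) 0 N
    ∣b∷S∣ true  = cong suc (∣∣≡count-indicator S)
    ∣b∷S∣ false = ∣∣≡count-indicator S

indicator-tabulate : ∀ N (g : ℕ → Bool) {i} → i < N → indicator (tabulate {n = N} (g ∘ toℕ)) i ≡ g i
indicator-tabulate (suc N) g {zero}  _         = refl
indicator-tabulate (suc N) g {suc i} (s≤s i<N) = indicator-tabulate N (g ∘ suc) i<N

module FullTree (k : ℕ) .{{_ : NonZero k}} where

  treeSize-suc : ∀ h → treeSize k (suc h) ≡ treeSize k h + k ^ suc h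
  treeSize-suc zero    = refl
  treeSize-suc (suc h) = cong suc (begin
    k * treeSize k (suc h)             ≡⟨ cong (k *_) (treeSize-suc h) ⟩
    k * (treeSize k h + k ^ suc h)     ≡⟨ *-distribˡ-+ k (treeSize k h) _ ⟩
    k * treeSize k h + k ^ suc (suc h) ∎)
    where open ≡-Reasoning

  treeSize≤treeSize-suc : ∀ h → treeSize k h ≤ treeSize k (suc h)
  treeSize≤treeSize-suc h = subst (treeSize k h ≤_) (sym (treeSize-suc h)) (m≤m+n _ _)

  child<treeSize : ∀ h {v} j → j < k → v < treeSize k h → k * v + suc j < treeSize k (suc h)
  child<treeSize h {v} j j<k v< = s≤s (begin
    k * v + suc j ≤⟨ +-monoʳ-≤ (k * v) j<k ⟩
    k * v + k     ≡⟨ +-comm (k * v) k ⟩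
    k + k * v     ≡⟨ sym (*-suc k v) ⟩
    k * suc v     ≤⟨ *-monoʳ-≤ k v< ⟩
    k * treeSize k h ∎)
    where open ≤-Reasoning

  child<treeSize⇒parent< : ∀ h {v} j → k * v + suc j < treeSize k (suc h) → v < treeSize k h
  child<treeSize⇒parent< h {v} j c< =
    *-cancelˡ-< k v (treeSize k h) (<-≤-trans (m<m+n (k * v) (s≤s z≤n)) (s≤s⁻¹ c<))

  child≢grandchild : ∀ v i j l → j < k → k * v + suc j ≢ k * (k * v + suc i) + suc l
  child≢grandchild v i j l j<k = <⇒≢ (begin-strict
    k * v + suc j               ≤⟨ +-monoʳ-≤ (k * v) j<k ⟩
    k * v + k                   ≤⟨ +-monoˡ-≤ k (m≤n*m (k * v) k) ⟩
    k * (k * v) + k             ≡⟨ cong (k * (k * v) +_) (sym (*-identityʳ k)) ⟩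
    k * (k * v) + k * 1         ≡⟨ sym (*-distribˡ-+ k (k * v) 1) ⟩
    k * (k * v + 1)             ≤⟨ *-monoʳ-≤ k (+-monoʳ-≤ (k * v) (s≤s z≤n)) ⟩
    k * (k * v + suc i)         <⟨ m<m+n _ (s≤s z≤n) ⟩
    k * (k * v + suc i) + suc l ∎)
    where open ≤-Reasoning

  count-twoLevels : ∀ f h → count f 0 (treeSize k (suc (suc h))) ≡
    count f 0 (treeSize k h) + (count f (treeSize k h) (k ^ suc h)
                                + count f (treeSize k (suc h)) (k ^ suc (suc h)))
  count-twoLevels f h = begin
    count f 0 (treeSize k (suc (suc h)))
      ≡⟨ cong (count f 0) (treeSize-suc (suc h)) ⟩
    count f 0 (treeSize k (suc h) + k ^ suc (suc h))
      ≡⟨ count-+ f 0 (treeSize k (suc h)) _ ⟩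
    count f 0 (treeSize k (suc h)) + count f (treeSize k (suc h)) (k ^ suc (suc h))
      ≡⟨ cong (_+ count f (treeSize k (suc h)) (k ^ suc (suc h)))
              (trans (cong (count f 0) (treeSize-suc h)) (count-+ f 0 (treeSize k h) _)) ⟩
    (count f 0 (treeSize k h) + count f (treeSize k h) (k ^ suc h))
      + count f (treeSize k (suc h)) (k ^ suc (suc h))
      ≡⟨ +-assoc (count f 0 (treeSize k h)) _ _ ⟩
    _ ∎
    where open ≡-Reasoning

  cdnFullTree : ℕ → ℕ
  cdnFullTree zero          = 0
  cdnFullTree (suc zero)    = 1
  cdnFullTree (suc (suc h)) = k ^ suc h + cdnFullTree h

  -- The vertices at depths h ∸ 1, h ∸ 3, …: every edge joins consecutive depths, so they cover it.
  deleted : ℕ → ℕ → Bool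
  deleted zero          _ = false
  deleted (suc zero)    v = does (v <? 1)
  deleted (suc (suc h)) v =
    if does (v <? treeSize k h) then deleted h v else does (v <? treeSize k (suc h))

  module _ (h : ℕ) {v : ℕ} where

    deleted-below : v < treeSize k h → deleted (suc (suc h)) v ≡ deleted h v
    deleted-below v< rewrite dec-true (v <? treeSize k h) v< = refl

    deleted-level : treeSize k h ≤ v → v < treeSize k (suc h) → deleted (suc (suc h)) v ≡ true
    deleted-level ≤v v< rewrite dec-false (v <? treeSize k h) (≤⇒≯ ≤v) =
      dec-true (v <? treeSize k (suc h)) v<

    deleted-above : treeSize k (suc h) ≤ v → deleted (suc (suc h)) v ≡ false
    deleted-above ≤v
      rewrite dec-false (v <? treeSize k h) (≤⇒≯ (≤-trans (treeSize≤treeSize-suc h) ≤v)) =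
      dec-false (v <? treeSize k (suc h)) (≤⇒≯ ≤v)

  deleted-covers : ∀ h v j → j < k → k * v + suc j < treeSize k h →
    deleted h v ≡ true ⊎ deleted h (k * v + suc j) ≡ true
  deleted-covers zero v j _ c< =
    ⊥-elim (<⇒≱ c< (≤-trans (s≤s z≤n) (m≤n+m (suc j) (k * v))))
  deleted-covers (suc zero) v j _ c< =
    inj₁ (dec-true (v <? 1) (child<treeSize⇒parent< 0 j c<))
  deleted-covers (suc (suc h)) v j j<k c< with v <? treeSize k h
  ... | no v≮ = inj₁ (deleted-level h (≮⇒≥ v≮) (child<treeSize⇒parent< (suc h) j c<))
  ... | yes v< with k * v + suc j <? treeSize k h
  ...   | yes c<′ = ⊎-map (trans (deleted-below h v<)) (trans (deleted-below h c<′))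
                      (deleted-covers h v j j<k c<′)
  ...   | no c≮   = inj₂ (deleted-level h (≮⇒≥ c≮) (child<treeSize h j j<k v<))

  count-deleted : ∀ h → count (deleted h) 0 (treeSize k h) ≡ cdnFullTree h
  count-deleted zero          = refl
  count-deleted (suc zero)    =
    cong suc (count-allFalse (deleted 1) 1 (k * 1) (λ v 1≤v _ → dec-false (v <? 1) (≤⇒≯ 1≤v)))
  count-deleted (suc (suc h)) = begin
    count D 0 (treeSize k (suc (suc h)))
      ≡⟨ count-twoLevels D h ⟩
    count D 0 (treeSize k h) + (count D (treeSize k h) (k ^ suc h)
                                + count D (treeSize k (suc h)) (k ^ suc (suc h)))
      ≡⟨ cong₂ _+_ (trans (count-cong D (deleted h) 0 _ lower) (count-deleted h))
                   (cong₂ _+_ (count-allTrue D _ _ middle) (count-allFalse D _ _ upper)) ⟩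
    cdnFullTree h + (k ^ suc h + 0)
      ≡⟨ trans (+-comm (cdnFullTree h) _) (cong (_+ cdnFullTree h) (+-identityʳ _)) ⟩
    k ^ suc h + cdnFullTree h ∎
    where
      open ≡-Reasoning
      D = deleted (suc (suc h))
      lower : AllIn 0 (treeSize k h) (λ v → D v ≡ deleted h v)
      lower v _ = deleted-below h
      middle : AllIn (treeSize k h) (k ^ suc h) (λ v → D v ≡ true)
      middle v ≤v v< = deleted-level h ≤v (subst (v <_) (sym (treeSize-suc h)) v<)
      upper : AllIn (treeSize k (suc h)) (k ^ suc (suc h)) (λ v → D v ≡ false)
      upper v ≤v _ = deleted-above h ≤v

  deletionSet : ∀ h → Subset (treeSize k h)
  deletionSet h = tabulate (deleted h ∘ toℕ)

  ∣deletionSet∣ : ∀ h → ∣ deletionSet h ∣ ≡ cdnFullTree h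
  ∣deletionSet∣ h = begin
    ∣ deletionSet h ∣                                   ≡⟨ ∣∣≡count-indicator (deletionSet h) ⟩
    count (indicator (deletionSet h)) 0 (treeSize k h) ≡⟨ count-cong _ _ 0 (treeSize k h) (λ v _ → indicator-tabulate _ (deleted h)) ⟩
    count (deleted h) 0 (treeSize k h)                 ≡⟨ count-deleted h ⟩
    cdnFullTree h ∎
    where open ≡-Reasoning

  deletionSet-clawFree : ∀ h → ClawFreeAfterDeleting (fullTree k h) (deletionSet h)
  deletionSet-clawFree h = edgeCover⇒clawFree (fullTree k h) (deletionSet h)
    [ parentOrChild∈ , swap ∘ parentOrChild∈ ]
    where
      ∈deletionSet : ∀ x → deleted h (toℕ x) ≡ true → x ∈ deletionSet h
      ∈deletionSet x d = indicator⇒∈ (deletionSet h) x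
        (trans (indicator-tabulate _ (deleted h) (toℕ<n x)) d)
      parentOrChild∈ : ∀ {u v} → ChildOf k v u → u ∈ deletionSet h ⊎ v ∈ deletionSet h
      parentOrChild∈ {u} {v} (c , v≡) =
        ⊎-map (∈deletionSet u) (∈deletionSet v ∘ trans (cong (deleted h) v≡))
          (deleted-covers h (toℕ u) (toℕ c) (toℕ<n c) (subst (_< treeSize k h) v≡ (toℕ<n v)))

  HitsStar : (ℕ → Bool) → ℕ → Set
  HitsStar f v = f v ≡ true ⊎ Σ (Fin k) λ c → f (k * v + suc (toℕ c)) ≡ true

  hitsStar⇒count≥1 : ∀ f v → HitsStar f v → 1 ≤ boolToℕ (f v) + count f (suc (k * v)) k
  hitsStar⇒count≥1 f v (inj₁ fv) rewrite fv = s≤s z≤n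
  hitsStar⇒count≥1 f v (inj₂ (c , fc)) =
    ≤-trans (count-pos f (suc (k * v)) (toℕ<n c) (trans (cong f (sym (+-suc (k * v) (toℕ c)))) fc))
            (m≤n+m _ (boolToℕ (f v)))

  -- The stars of A, …, A + n − 1 are disjoint, their centres and leaves forming two intervals.
  hitsStars⇒count≥ : ∀ f A n → AllIn A n (HitsStar f) →
    n ≤ count f A n + count f (suc (k * A)) (k * n)
  hitsStars⇒count≥ f A zero    _    = z≤n
  hitsStars⇒count≥ f A (suc n) hits = begin
    1 + n
      ≤⟨ +-mono-≤ (hitsStar⇒count≥1 f A (AllIn-head hits))
                  (hitsStars⇒count≥ f (suc A) n (AllIn-tail hits)) ⟩
    (boolToℕ (f A) + count f (suc (k * A)) k) + (count f (suc A) n + count f (suc (k * suc A)) (k * n))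
      ≡⟨ +-interchange (boolToℕ (f A)) _ _ _ ⟩
    count f A (suc n) + (count f (suc (k * A)) k + count f (suc (k * suc A)) (k * n))
      ≡⟨ cong (count f A (suc n) +_) (sym leaves) ⟩
    count f A (suc n) + count f (suc (k * A)) (k * suc n) ∎
    where
      open ≤-Reasoning
      leaves : count f (suc (k * A)) (k * suc n) ≡
               count f (suc (k * A)) k + count f (suc (k * suc A)) (k * n)
      leaves = begin-equality
        count f (suc (k * A)) (k * suc n)
          ≡⟨ cong (count f _) (*-suc k n) ⟩
        count f (suc (k * A)) (k + k * n)
          ≡⟨ count-+ f _ k (k * n) ⟩
        count f (suc (k * A)) k + count f (suc (k * A + k)) (k * n)
          ≡⟨ cong (λ a → count f (suc (k * A)) k + count f (suc a) (k * n)) (trans (+-comm (k * A) k) (sym (*-suc k A))) ⟩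
        count f (suc (k * A)) k + count f (suc (k * suc A)) (k * n) ∎

  cdnFullTree≤-step : ∀ h f → AllIn 0 (treeSize k (suc h)) (HitsStar f) →
    cdnFullTree h ≤ count f 0 (treeSize k h) →
    cdnFullTree (suc (suc h)) ≤ count f 0 (treeSize k (suc (suc h)))
  cdnFullTree≤-step h f hits below = begin
    k ^ suc h + cdnFullTree h
      ≤⟨ +-mono-≤ (hitsStars⇒count≥ f (treeSize k h) (k ^ suc h) levelHits) below ⟩
    levels + count f 0 (treeSize k h)
      ≡⟨ +-comm levels _ ⟩
    count f 0 (treeSize k h) + levels
      ≡⟨ sym (count-twoLevels f h) ⟩
    count f 0 (treeSize k (suc (suc h))) ∎
    where
      open ≤-Reasoning
      levels = count f (treeSize k h) (k ^ suc h) + count f (treeSize k (suc h)) (k ^ suc (suc h))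
      levelHits : AllIn (treeSize k h) (k ^ suc h) (HitsStar f)
      levelHits v _ v< = hits v z≤n (subst (v <_) (sym (treeSize-suc h)) v<)

  hitsStars⇒cdnFullTree≤ : ∀ h f → AllIn 0 (treeSize k h) (HitsStar f) →
    cdnFullTree (suc h) ≤ count f 0 (treeSize k (suc h))
  hitsStars⇒cdnFullTree≤ zero f hits =
    subst (1 ≤_) root (hitsStar⇒count≥1 f 0 (hits 0 z≤n (s≤s z≤n)))
    where
      root : boolToℕ (f 0) + count f (suc (k * 0)) k ≡ count f 0 (treeSize k 1)
      root = cong₂ (λ a b → boolToℕ (f 0) + count f (suc a) b) (*-zeroʳ k) (sym (*-identityʳ k))
  hitsStars⇒cdnFullTree≤ (suc zero)    f hits = cdnFullTree≤-step 0 f hits z≤n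
  hitsStars⇒cdnFullTree≤ (suc (suc h)) f hits = cdnFullTree≤-step (suc h) f hits
    (hitsStars⇒cdnFullTree≤ h f (AllIn-shrink
      (≤-trans (treeSize≤treeSize-suc h) (treeSize≤treeSize-suc (suc h))) hits))

  module Star (h : ℕ) {v : ℕ} (v< : v < treeSize k h) where

    centre : Fin (treeSize k (suc h))
    centre = fromℕ< (<-≤-trans v< (treeSize≤treeSize-suc h))

    child : Fin k → Fin (treeSize k (suc h))
    child c = fromℕ< (child<treeSize h (toℕ c) (toℕ<n c) v<)

    toℕ-child : ∀ c → toℕ (child c) ≡ k * v + suc (toℕ c)
    toℕ-child c = toℕ-fromℕ< _

    centre-adj : ∀ c → TreeAdj k (suc h) centre (child c)
    centre-adj c =
      inj₁ (c , trans (toℕ-child c) (cong (λ x → k * x + suc (toℕ c)) (sym (toℕ-fromℕ< _))))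

    child-injective : ∀ {c c′} → child c ≡ child c′ → c ≡ c′
    child-injective {c} {c′} eq = toℕ-injective (suc-injective (+-cancelˡ-≡ (k * v) _ _
      (trans (sym (toℕ-child c)) (trans (cong toℕ eq) (toℕ-child c′)))))

    ¬childOfSibling : ∀ c c′ → ¬ ChildOf k (child c′) (child c)
    ¬childOfSibling c c′ (l , eq) = child≢grandchild v (toℕ c) (toℕ c′) (toℕ l) (toℕ<n c′)
      (trans (sym (toℕ-child c′)) (trans eq (cong (λ x → k * x + suc (toℕ l)) (toℕ-child c))))

    siblings-nonadjacent : ∀ c c′ → ¬ TreeAdj k (suc h) (child c) (child c′)
    siblings-nonadjacent c c′ = [ ¬childOfSibling c c′ , ¬childOfSibling c′ c ]

  clawFree⇒hitsStars : (c₀ c₁ c₂ : Fin k) → c₀ ≢ c₁ → c₀ ≢ c₂ → c₁ ≢ c₂ →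
    ∀ h (S : Subset (treeSize k (suc h))) → ClawFreeAfterDeleting (fullTree k (suc h)) S →
    AllIn 0 (treeSize k h) (HitsStar (indicator S))
  clawFree⇒hitsStars c₀ c₁ c₂ c₀≢c₁ c₀≢c₂ c₁≢c₂ h S clawFree v _ v< =
    [ centreHits , [ childHits c₀ , [ childHits c₁ , childHits c₂ ] ] ]
      (clawFree⇒clawMeets (fullTree k (suc h)) S clawFree
        (c₀≢c₁ ∘ child-injective) (c₀≢c₂ ∘ child-injective) (c₁≢c₂ ∘ child-injective)
        (centre-adj c₀) (centre-adj c₁) (centre-adj c₂)
        (siblings-nonadjacent c₀ c₁) (siblings-nonadjacent c₀ c₂) (siblings-nonadjacent c₁ c₂))
    where
      open Star h v<
      centreHits : centre ∈ S → HitsStar (indicator S) v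
      centreHits c∈S = inj₁ (trans (cong (indicator S) (sym (toℕ-fromℕ< _))) (∈⇒indicator c∈S))
      childHits : ∀ c → child c ∈ S → HitsStar (indicator S) v
      childHits c c∈S = inj₂ (c , trans (cong (indicator S) (sym (toℕ-child c))) (∈⇒indicator c∈S))

  clawFree⇒cdnFullTree≤ : (c₀ c₁ c₂ : Fin k) → c₀ ≢ c₁ → c₀ ≢ c₂ → c₁ ≢ c₂ →
    ∀ h (S : Subset (treeSize k h)) → ClawFreeAfterDeleting (fullTree k h) S →
    cdnFullTree h ≤ ∣ S ∣
  clawFree⇒cdnFullTree≤ _ _ _ _ _ _ zero _ _ = z≤n
  clawFree⇒cdnFullTree≤ c₀ c₁ c₂ c₀≢c₁ c₀≢c₂ c₁≢c₂ (suc h) S clawFree =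
    subst (cdnFullTree (suc h) ≤_) (sym (∣∣≡count-indicator S))
      (hitsStars⇒cdnFullTree≤ h (indicator S)
        (clawFree⇒hitsStars c₀ c₁ c₂ c₀≢c₁ c₀≢c₂ c₁≢c₂ h S clawFree))

  k²∸1+1 : suc (k * k ∸ 1) ≡ k * k
  k²∸1+1 = suc-pred (k * k) {{m*n≢0 k k}}

  cdnFullTree-closedForm : ∀ h → cdnFullTree h * (k * k ∸ 1) + k ^ ((h + 1) % 2) ≡ k ^ (h + 1)
  cdnFullTree-closedForm zero          = refl
  cdnFullTree-closedForm (suc zero)    = begin
    (k * k ∸ 1 + 0) + 1 ≡⟨ cong (_+ 1) (+-identityʳ _) ⟩
    k * k ∸ 1 + 1       ≡⟨ +-comm _ 1 ⟩
    suc (k * k ∸ 1)     ≡⟨ k²∸1+1 ⟩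
    k * k               ≡⟨ cong (k *_) (sym (*-identityʳ k)) ⟩
    k * (k * 1)         ∎
    where open ≡-Reasoning
  cdnFullTree-closedForm (suc (suc h)) = begin
    (k ^ suc h + cdnFullTree h) * q + k ^ ((h + 1) % 2)
      ≡⟨ cong (λ e → (k ^ e + cdnFullTree h) * q + k ^ ((h + 1) % 2)) (+-comm 1 h) ⟩
    (x + cdnFullTree h) * q + k ^ ((h + 1) % 2)
      ≡⟨ cong (_+ k ^ ((h + 1) % 2)) (*-distribʳ-+ q x (cdnFullTree h)) ⟩
    (x * q + cdnFullTree h * q) + k ^ ((h + 1) % 2)
      ≡⟨ +-assoc (x * q) _ _ ⟩
    x * q + (cdnFullTree h * q + k ^ ((h + 1) % 2))
      ≡⟨ cong (x * q +_) (cdnFullTree-closedForm h) ⟩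
    x * q + x   ≡⟨ +-comm (x * q) x ⟩
    x + x * q   ≡⟨ sym (*-suc x q) ⟩
    x * suc q   ≡⟨ cong (x *_) k²∸1+1 ⟩
    x * (k * k) ≡⟨ *-comm x (k * k) ⟩
    k * k * x   ≡⟨ *-assoc k k x ⟩
    k * (k * x) ∎
    where
      open ≡-Reasoning
      q = k * k ∸ 1
      x = k ^ (h + 1)

theorem9 : (k h : ℕ) → 3 ≤ k →
    Σ ℕ λ m → IsCdn (fullTree k h) m ×
    m * (k * k ∸ 1) + k ^ ((h + 1) % 2) ≡ k ^ (h + 1)
theorem9 k h (s≤s (s≤s (s≤s _))) =
  cdnFullTree h ,
  ((deletionSet h , deletionSet-clawFree h , ∣deletionSet∣ h) ,
   clawFree⇒cdnFullTree≤ fzero (fsuc fzero) (fsuc (fsuc fzero)) (λ ()) (λ ()) (λ ()) h) ,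
  cdnFullTree-closedForm h
  where open FullTree k
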